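{- Let $\gamma,\lambda\in\mathbb{N}_0$ with $(\lambda,\gamma)\neq(0,0)$ and let $\beta$ be a positive integer. Let $H_n(\lambda,\beta,\gamma)$ denote the coefficient of $\frac{x^n}{n!}$ in $\frac{e^{\gamma x}}{(2-e^{\beta x})^{\lambda}}$. Then for every $n\in\mathbb{N}_0$, $$H_{n+1}(\lambda,\beta,\gamma)=\gamma H_n(\lambda,\beta,\gamma)+\lambda\beta\sum_{i=0}^{n}\binom{n}{i}H_i(1,\beta,\beta)H_{n-i}(\lambda,\beta,\gamma).$$ -}

module Defs where

open import Data.Nat as ℕ using (ℕ; zero; suc; _∸_; _≡ᵇ_)
open import Data.Nat.Combinatorics using (_C_)
open import Data.Integer using (ℤ; +_; _+_; _*_; -_; _-_; _^_)
open import Data.Bool using (if_then_else_)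

-- Exponential generating functions over ℤ, represented by their sequence
-- of EGF coefficients: f represents  Σ_n f n · x^n / n!.
EGF : Set
EGF = ℕ → ℤ

sumTo : ℕ → (ℕ → ℤ) → ℤ
sumTo zero    f = f 0
sumTo (suc n) f = sumTo n f + f (suc n)

_⊛_ : EGF → EGF → EGF
(f ⊛ g) n = sumTo n (λ i → + (n C i) * (f i * g (n ∸ i)))

infixl 7 _⊛_

const : ℤ → EGF
const c zero    = c
const c (suc n) = + 0

expS : ℤ → EGF
expS c n = c ^ n

_⊖_ : EGF → EGF → EGF
(f ⊖ g) n = f n - g n

powS : EGF → ℕ → EGF
powS f zero    = const (+ 1)
powS f (suc k) = f ⊛ powS f k

-- Multiplicative inverse of an EGF f with constant term 1:
-- g 0 = 1,  g n = - Σ_{i=1}^{n} C(n,i) f i g (n-i).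
-- invTable f n agrees with the inverse on all indices ≤ n.
invTable : EGF → ℕ → EGF
invTable f zero    = λ _ → + 1
invTable f (suc n) = λ k → if k ≡ᵇ suc n then v else t k
  where
  t : EGF
  t = invTable f n
  v : ℤ
  v = - sumTo n (λ j → + (suc n C suc j) * (f (suc j) * t (n ∸ j)))

invS : EGF → EGF
invS f n = invTable f n n

H : ℕ → ℕ → ℕ → ℕ → ℤ
H n λ' β γ = (expS (+ γ) ⊛ invS (powS (const (+ 2) ⊖ expS (+ β)) λ')) n

module Submission where

-- The shift ∂ f = f ∘ suc is differentiation of EGFs and satisfies the Leibniz rule for ⊛,
-- from which commutativity, associativity and the unit law follow by induction on the index.
-- If f 0 = 1 and ∂ f = w ⊛ f then ∂ (f ^ k) = k w f ^ k and ∂ (f ⁻¹) = − w f ⁻¹.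
-- For D = 2 − e^{βx} one has ∂ D = −β e^{βx} = (−β G) D with G = e^{βx} / D, the EGF of
-- H(1, β, β); hence ∂ (D ^ λ)⁻¹ = λβ G (D ^ λ)⁻¹, and the Leibniz rule applied to
-- e^{γx} (D ^ λ)⁻¹ is the recurrence.

open import Defs
open import Data.Nat using (ℕ; zero; suc; _∸_; _≤_; _<_; z≤n; s≤s; _≡ᵇ_) renaming (_*_ to _*ℕ_)
open import Data.Nat.Combinatorics using (_C_; nCk+nC[k+1]≡[n+1]C[k+1]; k>n⇒nCk≡0)
open import Data.Integer using (ℤ; +_; _+_; _*_; -_; _^_; 0ℤ; 1ℤ; -1ℤ)
open import Data.Integer.Tactic.RingSolver using (solve-∀)
open import Data.Product using (_,_)
open import Data.Sum using (inj₁; inj₂)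
open import Data.Bool using (true; false)
open import Function using (_∘_)
open import Level using (0ℓ)
open import Algebra.Bundles using (CommutativeMonoid; AbelianGroup)
open import Relation.Binary.Structures using (IsEquivalence)
open import Relation.Binary.PropositionalEquality
import Data.Nat.Properties as ℕ
import Data.Integer.Properties as ℤ
import Algebra.Properties.CommutativeSemigroup as CommSemigroupProperties
import Relation.Binary.Reasoning.Setoid as SetoidReasoning

open import Algebra.Properties.Group (AbelianGroup.group ℤ.+-0-abelianGroup) using (inverseʳ-unique)

open CommSemigroupProperties ℤ.+-commutativeSemigroup using ()
  renaming (interchange to +-interchange; x∙yz≈y∙xz to +-leftComm)

≗-isEquivalence : IsEquivalence (_≗_ {A = ℕ} {B = ℤ})
≗-isEquivalence = record
  { refl = λ _ → refl ; sym = λ p n → sym (p n) ; trans = λ p q n → trans (p n) (q n) }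

∂ : EGF → EGF
∂ f n = f (suc n)

infixl 6 _⊕_
_⊕_ : EGF → EGF → EGF
(f ⊕ g) n = f n + g n

infixr 8 _·_
_·_ : ℤ → EGF → EGF
(c · f) n = c * f n

zeroS : EGF
zeroS _ = 0ℤ

one : EGF
one = const 1ℤ

sumTo-cong : ∀ n {f g : ℕ → ℤ} → (∀ i → i ≤ n → f i ≡ g i) → sumTo n f ≡ sumTo n g
sumTo-cong zero    f≡g = f≡g 0 z≤n
sumTo-cong (suc n) f≡g =
  cong₂ _+_ (sumTo-cong n (λ i i≤n → f≡g i (ℕ.m≤n⇒m≤1+n i≤n))) (f≡g (suc n) ℕ.≤-refl)

sumTo-+ : ∀ n (f g : ℕ → ℤ) → sumTo n (λ i → f i + g i) ≡ sumTo n f + sumTo n g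
sumTo-+ zero    f g = refl
sumTo-+ (suc n) f g =
  trans (cong (_+ (f (suc n) + g (suc n))) (sumTo-+ n f g))
        (+-interchange (sumTo n f) (sumTo n g) (f (suc n)) (g (suc n)))

*-distribˡ-sumTo : ∀ n c (f : ℕ → ℤ) → c * sumTo n f ≡ sumTo n (λ i → c * f i)
*-distribˡ-sumTo zero    c f = refl
*-distribˡ-sumTo (suc n) c f =
  trans (ℤ.*-distribˡ-+ c _ _) (cong (_+ c * f (suc n)) (*-distribˡ-sumTo n c f))

sumTo-zero : ∀ n (f : ℕ → ℤ) → (∀ i → f i ≡ 0ℤ) → sumTo n f ≡ 0ℤ
sumTo-zero zero    f f≡0 = f≡0 0
sumTo-zero (suc n) f f≡0 = cong₂ _+_ (sumTo-zero n f f≡0) (f≡0 (suc n))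

sumTo-shift : ∀ n (h : ℕ → ℤ) → sumTo (suc n) h ≡ h 0 + sumTo n (h ∘ suc)
sumTo-shift zero    h = refl
sumTo-shift (suc n) h =
  trans (cong (_+ h (suc (suc n))) (sumTo-shift n h)) (ℤ.+-assoc (h 0) _ _)

sumTo-dropLast : ∀ n (h : ℕ → ℤ) → h (suc n) ≡ 0ℤ → sumTo (suc n) h ≡ sumTo n h
sumTo-dropLast n h h≡0 = trans (cong (_+_ (sumTo n h)) h≡0) (ℤ.+-identityʳ _)

·-congˡ : ∀ c {f g} → f ≗ g → c · f ≗ c · g
·-congˡ c f≗g n = cong (c *_) (f≗g n)

·-assoc : ∀ c d f → (c * d) · f ≗ c · (d · f)
·-assoc c d f n = ℤ.*-assoc c d (f n)

⊛-cong : ∀ {f f′ g g′} → f ≗ f′ → g ≗ g′ → f ⊛ g ≗ f′ ⊛ g′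
⊛-cong f≗f′ g≗g′ n =
  sumTo-cong n (λ i _ → cong₂ (λ a b → + (n C i) * (a * b)) (f≗f′ i) (g≗g′ (n ∸ i)))

⊛-congˡ : ∀ {f g g′} → g ≗ g′ → f ⊛ g ≗ f ⊛ g′
⊛-congˡ {f} = ⊛-cong {f} {f} (λ _ → refl)

⊛-congʳ : ∀ {f f′ g} → f ≗ f′ → f ⊛ g ≗ f′ ⊛ g
⊛-congʳ {g = g} f≗f′ = ⊛-cong {g = g} {g} f≗f′ (λ _ → refl)

⊛-distribʳ : ∀ f g h → (f ⊕ g) ⊛ h ≗ f ⊛ h ⊕ g ⊛ h
⊛-distribʳ f g h n = trans (sumTo-cong n (λ i _ → distrib (+ (n C i)) (f i) (g i) (h (n ∸ i))))
                           (sumTo-+ n _ _)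
  where
  distrib : ∀ c a b x → c * ((a + b) * x) ≡ c * (a * x) + c * (b * x)
  distrib = solve-∀

⊛-distribˡ : ∀ f g h → f ⊛ (g ⊕ h) ≗ f ⊛ g ⊕ f ⊛ h
⊛-distribˡ f g h n = trans (sumTo-cong n (λ i _ → distrib (+ (n C i)) (f i) (g (n ∸ i)) (h (n ∸ i))))
                           (sumTo-+ n _ _)
  where
  distrib : ∀ c x a b → c * (x * (a + b)) ≡ c * (x * a) + c * (x * b)
  distrib = solve-∀

⊛-scaleˡ : ∀ c f g → (c · f) ⊛ g ≗ c · (f ⊛ g)
⊛-scaleˡ c f g n = trans (sumTo-cong n (λ i _ → pull (+ (n C i)) c (f i) (g (n ∸ i))))
                         (sym (*-distribˡ-sumTo n c _))
  where
  pull : ∀ k c a b → k * ((c * a) * b) ≡ c * (k * (a * b))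
  pull = solve-∀

⊛-scaleʳ : ∀ c f g → f ⊛ (c · g) ≗ c · (f ⊛ g)
⊛-scaleʳ c f g n = trans (sumTo-cong n (λ i _ → pull (+ (n C i)) c (f i) (g (n ∸ i))))
                         (sym (*-distribˡ-sumTo n c _))
  where
  pull : ∀ k c a b → k * (a * (c * b)) ≡ c * (k * (a * b))
  pull = solve-∀

⊛-zeroˡ : ∀ g → zeroS ⊛ g ≗ zeroS
⊛-zeroˡ g n = sumTo-zero n _ (λ i → ℤ.*-zeroʳ (+ (n C i)))

⊛-∂ʳ-unfold : ∀ f g n →
  (f ⊛ ∂ g) n ≡ 1ℤ * (f 0 * g (suc n)) + sumTo n (λ i → + (n C suc i) * (f (suc i) * g (n ∸ i)))
⊛-∂ʳ-unfold f g zero = sym (ℤ.+-identityʳ _)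
⊛-∂ʳ-unfold f g (suc m) = begin
    (f ⊛ ∂ g) (suc m)
  ≡⟨ sumTo-shift m _ ⟩
    h₀ + sumTo m (λ i → + (suc m C suc i) * (f (suc i) * g (suc (m ∸ i))))
  ≡⟨ cong (_+_ h₀) (sumTo-cong m (λ i i≤m →
       cong (λ k → + (suc m C suc i) * (f (suc i) * g k)) (sym (ℕ.+-∸-assoc 1 i≤m)))) ⟩
    h₀ + sumTo m t
  ≡⟨ cong (_+_ h₀) (sumTo-dropLast m t t[1+m]≡0) ⟨
    h₀ + sumTo (suc m) t
  ∎
  where
  open ≡-Reasoning
  h₀ : ℤ
  h₀ = 1ℤ * (f 0 * g (suc (suc m)))
  t : ℕ → ℤ
  t i = + (suc m C suc i) * (f (suc i) * g (suc m ∸ i))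
  t[1+m]≡0 : t (suc m) ≡ 0ℤ
  t[1+m]≡0 = cong (λ k → + k * (f (suc (suc m)) * g (m ∸ m))) (k>n⇒nCk≡0 (ℕ.n<1+n (suc m)))

∂-⊛ : ∀ f g → ∂ (f ⊛ g) ≗ ∂ f ⊛ g ⊕ f ⊛ ∂ g
∂-⊛ f g n = begin
    (f ⊛ g) (suc n)
  ≡⟨ sumTo-shift n _ ⟩
    h₀ + sumTo n (λ i → + (suc n C suc i) * a i)
  ≡⟨ cong (_+_ h₀) (sumTo-cong n (λ i _ → pascal i)) ⟩
    h₀ + sumTo n (λ i → + (n C i) * a i + + (n C suc i) * a i)
  ≡⟨ cong (_+_ h₀) (sumTo-+ n _ _) ⟩
    h₀ + ((∂ f ⊛ g) n + sumTo n (λ i → + (n C suc i) * a i))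
  ≡⟨ +-leftComm h₀ ((∂ f ⊛ g) n) _ ⟩
    (∂ f ⊛ g) n + (h₀ + sumTo n (λ i → + (n C suc i) * a i))
  ≡⟨ cong (_+_ ((∂ f ⊛ g) n)) (⊛-∂ʳ-unfold f g n) ⟨
    (∂ f ⊛ g) n + (f ⊛ ∂ g) n
  ∎
  where
  open ≡-Reasoning
  h₀ : ℤ
  h₀ = 1ℤ * (f 0 * g (suc n))
  a : ℕ → ℤ
  a i = f (suc i) * g (n ∸ i)
  pascal : ∀ i → + (suc n C suc i) * a i ≡ + (n C i) * a i + + (n C suc i) * a i
  pascal i = trans (cong (λ k → + k * a i) (sym (nCk+nC[k+1]≡[n+1]C[k+1] n i)))
                   (ℤ.*-distribʳ-+ (a i) (+ (n C i)) (+ (n C suc i)))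

⊛-comm : ∀ f g → f ⊛ g ≗ g ⊛ f
⊛-comm f g zero    = cong (1ℤ *_) (ℤ.*-comm (f 0) (g 0))
⊛-comm f g (suc n) = begin
    (f ⊛ g) (suc n)
  ≡⟨ ∂-⊛ f g n ⟩
    (∂ f ⊛ g) n + (f ⊛ ∂ g) n
  ≡⟨ cong₂ _+_ (⊛-comm (∂ f) g n) (⊛-comm f (∂ g) n) ⟩
    (g ⊛ ∂ f) n + (∂ g ⊛ f) n
  ≡⟨ ℤ.+-comm ((g ⊛ ∂ f) n) _ ⟩
    (∂ g ⊛ f) n + (g ⊛ ∂ f) n
  ≡⟨ ∂-⊛ g f n ⟨
    (g ⊛ f) (suc n)
  ∎
  where open ≡-Reasoning

⊛-assoc : ∀ f g h → (f ⊛ g) ⊛ h ≗ f ⊛ (g ⊛ h)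
⊛-assoc f g h zero = assoc₀ (f 0) (g 0) (h 0)
  where
  assoc₀ : ∀ a b c → 1ℤ * ((1ℤ * (a * b)) * c) ≡ 1ℤ * (a * (1ℤ * (b * c)))
  assoc₀ = solve-∀
⊛-assoc f g h (suc n) = begin
    ((f ⊛ g) ⊛ h) (suc n)
  ≡⟨ ∂-⊛ (f ⊛ g) h n ⟩
    (∂ (f ⊛ g) ⊛ h) n + ((f ⊛ g) ⊛ ∂ h) n
  ≡⟨ cong (_+ ((f ⊛ g) ⊛ ∂ h) n)
          (trans (⊛-congʳ {g = h} (∂-⊛ f g) n) (⊛-distribʳ (∂ f ⊛ g) (f ⊛ ∂ g) h n)) ⟩
    ((∂ f ⊛ g) ⊛ h) n + ((f ⊛ ∂ g) ⊛ h) n + ((f ⊛ g) ⊛ ∂ h) n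
  ≡⟨ cong₂ _+_ (cong₂ _+_ (⊛-assoc (∂ f) g h n) (⊛-assoc f (∂ g) h n)) (⊛-assoc f g (∂ h) n) ⟩
    (∂ f ⊛ (g ⊛ h)) n + (f ⊛ (∂ g ⊛ h)) n + (f ⊛ (g ⊛ ∂ h)) n
  ≡⟨ ℤ.+-assoc ((∂ f ⊛ (g ⊛ h)) n) _ _ ⟩
    (∂ f ⊛ (g ⊛ h)) n + ((f ⊛ (∂ g ⊛ h)) n + (f ⊛ (g ⊛ ∂ h)) n)
  ≡⟨ cong (_+_ ((∂ f ⊛ (g ⊛ h)) n))
          (trans (⊛-congˡ {f} (∂-⊛ g h) n) (⊛-distribˡ f (∂ g ⊛ h) (g ⊛ ∂ h) n)) ⟨
    (∂ f ⊛ (g ⊛ h)) n + (f ⊛ ∂ (g ⊛ h)) n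
  ≡⟨ ∂-⊛ f (g ⊛ h) n ⟨
    (f ⊛ (g ⊛ h)) (suc n)
  ∎
  where open ≡-Reasoning

⊛-identityˡ : ∀ f → one ⊛ f ≗ f
⊛-identityˡ f zero    = trans (ℤ.*-identityˡ _) (ℤ.*-identityˡ (f 0))
⊛-identityˡ f (suc n) = begin
    (one ⊛ f) (suc n)
  ≡⟨ ∂-⊛ one f n ⟩
    (zeroS ⊛ f) n + (one ⊛ ∂ f) n
  ≡⟨ cong₂ _+_ (⊛-zeroˡ f n) (⊛-identityˡ (∂ f) n) ⟩
    0ℤ + f (suc n)
  ≡⟨ ℤ.+-identityˡ _ ⟩
    f (suc n)
  ∎
  where open ≡-Reasoning

⊛-identityʳ : ∀ f → f ⊛ one ≗ f
⊛-identityʳ f n = trans (⊛-comm f one n) (⊛-identityˡ f n)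

⊛-commutativeMonoid : CommutativeMonoid 0ℓ 0ℓ
⊛-commutativeMonoid = record
  { Carrier = EGF
  ; _≈_ = _≗_
  ; _∙_ = _⊛_
  ; ε = one
  ; isCommutativeMonoid = record
    { isMonoid = record
      { isSemigroup = record
        { isMagma = record { isEquivalence = ≗-isEquivalence ; ∙-cong = ⊛-cong }
        ; assoc = ⊛-assoc
        }
      ; identity = ⊛-identityˡ , ⊛-identityʳ
      }
    ; comm = ⊛-comm
    }
  }

open CommutativeMonoid ⊛-commutativeMonoid using (commutativeSemigroup) renaming (setoid to ≗-setoid)
open CommSemigroupProperties commutativeSemigroup using () renaming (x∙yz≈y∙xz to ⊛-leftComm)
module ≗-Reasoning = SetoidReasoning ≗-setoid

≡ᵇ-refl : ∀ n → (n ≡ᵇ n) ≡ true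
≡ᵇ-refl zero    = refl
≡ᵇ-refl (suc n) = ≡ᵇ-refl n

<⇒≡ᵇ-false : ∀ {k n} → k < n → (k ≡ᵇ n) ≡ false
<⇒≡ᵇ-false {zero}  {suc n} _         = refl
<⇒≡ᵇ-false {suc k} {suc n} (s≤s k<n) = <⇒≡ᵇ-false k<n

invTable-stable : ∀ f m {k} → k ≤ m → invTable f m k ≡ invS f k
invTable-stable f zero    z≤n = refl
invTable-stable f (suc m) k≤1+m with ℕ.m≤n⇒m<n∨m≡n k≤1+m
... | inj₁ k<1+m rewrite <⇒≡ᵇ-false k<1+m = invTable-stable f m (ℕ.≤-pred k<1+m)
... | inj₂ refl  = refl

invS-suc : ∀ f n → invS f (suc n) ≡ - sumTo n (λ j → + (suc n C suc j) * (f (suc j) * invS f (n ∸ j)))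
invS-suc f n rewrite ≡ᵇ-refl n =
  cong -_ (sumTo-cong n (λ j _ → cong (λ x → + (suc n C suc j) * (f (suc j) * x))
                                      (invTable-stable f n (ℕ.m∸n≤m n j))))

⊛-inverseʳ : ∀ f → f 0 ≡ 1ℤ → f ⊛ invS f ≗ one
⊛-inverseʳ f f₀≡1 zero rewrite f₀≡1 = refl
⊛-inverseʳ f f₀≡1 (suc n) = begin
    (f ⊛ invS f) (suc n)
  ≡⟨ sumTo-shift n _ ⟩
    1ℤ * (f 0 * invS f (suc n)) + s
  ≡⟨ cong (λ x → 1ℤ * (x * invS f (suc n)) + s) f₀≡1 ⟩
    1ℤ * (1ℤ * invS f (suc n)) + s
  ≡⟨ cong (_+ s) (trans (ℤ.*-identityˡ _) (ℤ.*-identityˡ (invS f (suc n)))) ⟩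
    invS f (suc n) + s
  ≡⟨ cong (_+ s) (invS-suc f n) ⟩
    - s + s
  ≡⟨ ℤ.+-inverseˡ s ⟩
    0ℤ
  ∎
  where
  open ≡-Reasoning
  s : ℤ
  s = sumTo n (λ j → + (suc n C suc j) * (f (suc j) * invS f (n ∸ j)))

⊛-inverseˡ : ∀ f → f 0 ≡ 1ℤ → invS f ⊛ f ≗ one
⊛-inverseˡ f f₀≡1 n = trans (⊛-comm (invS f) f n) (⊛-inverseʳ f f₀≡1 n)

∂-powS : ∀ {u w} → ∂ u ≗ w ⊛ u → ∀ k → ∂ (powS u k) ≗ (+ k) · (w ⊛ powS u k)
∂-powS {u} {w} _ zero n = sym (ℤ.*-zeroˡ ((w ⊛ one) n))
∂-powS {u} {w} ∂u≗wu (suc k) n = begin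
    ∂ (u ⊛ p) n
  ≡⟨ ∂-⊛ u p n ⟩
    (∂ u ⊛ p) n + (u ⊛ ∂ p) n
  ≡⟨ cong₂ _+_ (trans (⊛-congʳ {g = p} ∂u≗wu n) (⊛-assoc w u p n))
               (trans (⊛-congˡ {u} (∂-powS {u} {w} ∂u≗wu k) n) (⊛-scaleʳ (+ k) u (w ⊛ p) n)) ⟩
    (w ⊛ (u ⊛ p)) n + + k * (u ⊛ (w ⊛ p)) n
  ≡⟨ cong (λ x → (w ⊛ (u ⊛ p)) n + + k * x) (⊛-leftComm u w p n) ⟩
    (w ⊛ (u ⊛ p)) n + + k * (w ⊛ (u ⊛ p)) n
  ≡⟨ ℤ.suc-* (+ k) ((w ⊛ (u ⊛ p)) n) ⟨
    + suc k * (w ⊛ (u ⊛ p)) n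
  ∎
  where
  open ≡-Reasoning
  p : EGF
  p = powS u k

∂-invS : ∀ {f w} → f 0 ≡ 1ℤ → ∂ f ≗ w ⊛ f → ∂ (invS f) ≗ -1ℤ · (w ⊛ invS f)
∂-invS {f} {w} f₀≡1 ∂f≗wf = begin
    ∂ g
  ≈⟨ ⊛-identityˡ (∂ g) ⟨
    one ⊛ ∂ g
  ≈⟨ ⊛-congʳ {g = ∂ g} (⊛-inverseˡ f f₀≡1) ⟨
    (g ⊛ f) ⊛ ∂ g
  ≈⟨ ⊛-assoc g f (∂ g) ⟩
    g ⊛ (f ⊛ ∂ g)
  ≈⟨ ⊛-congˡ {g} f⊛∂g≗-w ⟩
    g ⊛ (-1ℤ · w)
  ≈⟨ ⊛-scaleʳ -1ℤ g w ⟩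
    -1ℤ · (g ⊛ w)
  ≈⟨ ·-congˡ -1ℤ (⊛-comm g w) ⟩
    -1ℤ · (w ⊛ g)
  ∎
  where
  open ≗-Reasoning
  g : EGF
  g = invS f
  ∂f⊛g≗w : ∂ f ⊛ g ≗ w
  ∂f⊛g≗w = begin
    ∂ f ⊛ g        ≈⟨ ⊛-congʳ {g = g} ∂f≗wf ⟩
    (w ⊛ f) ⊛ g    ≈⟨ ⊛-assoc w f g ⟩
    w ⊛ (f ⊛ g)    ≈⟨ ⊛-congˡ {w} (⊛-inverseʳ f f₀≡1) ⟩
    w ⊛ one        ≈⟨ ⊛-identityʳ w ⟩
    w              ∎
  f⊛∂g≗-w : f ⊛ ∂ g ≗ -1ℤ · w
  f⊛∂g≗-w n = trans (inverseʳ-unique (w n) ((f ⊛ ∂ g) n) w+f⊛∂g≡0) (sym (ℤ.-1*i≡-i (w n)))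
    where
    w+f⊛∂g≡0 : w n + (f ⊛ ∂ g) n ≡ 0ℤ
    w+f⊛∂g≡0 = trans (cong (_+ (f ⊛ ∂ g) n) (sym (∂f⊛g≗w n)))
                     (trans (sym (∂-⊛ f g n)) (⊛-inverseʳ f f₀≡1 (suc n)))

powS-head : ∀ {f} → f 0 ≡ 1ℤ → ∀ k → powS f k 0 ≡ 1ℤ
powS-head f₀≡1 zero = refl
powS-head {f} f₀≡1 (suc k) rewrite f₀≡1 | powS-head {f} f₀≡1 k = refl

∂-invS-powS : ∀ {f w} → f 0 ≡ 1ℤ → ∂ f ≗ w ⊛ f → ∀ k →
  ∂ (invS (powS f k)) ≗ (- + k) · (w ⊛ invS (powS f k))
∂-invS-powS {f} {w} f₀≡1 ∂f≗wf k = begin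
    ∂ (invS p)
  ≈⟨ ∂-invS {p} {(+ k) · w} (powS-head f₀≡1 k) ∂p≗kwp ⟩
    -1ℤ · (((+ k) · w) ⊛ invS p)
  ≈⟨ ·-congˡ -1ℤ (⊛-scaleˡ (+ k) w (invS p)) ⟩
    -1ℤ · ((+ k) · (w ⊛ invS p))
  ≈⟨ ·-assoc -1ℤ (+ k) (w ⊛ invS p) ⟨
    (-1ℤ * + k) · (w ⊛ invS p)
  ≈⟨ (λ n → cong (_* (w ⊛ invS p) n) (ℤ.-1*i≡-i (+ k))) ⟩
    (- + k) · (w ⊛ invS p)
  ∎
  where
  open ≗-Reasoning
  p : EGF
  p = powS f k
  ∂p≗kwp : ∂ p ≗ ((+ k) · w) ⊛ p
  ∂p≗kwp n = trans (∂-powS {f} {w} ∂f≗wf k n) (sym (⊛-scaleˡ (+ k) w p n))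

D : ℕ → EGF
D β = const (+ 2) ⊖ expS (+ β)

G : ℕ → EGF
G β = expS (+ β) ⊛ invS (powS (D β) 1)

∂-D : ∀ β → ∂ (D β) ≗ (- + β) · expS (+ β)
∂-D β n = trans (ℤ.+-identityˡ _) (ℤ.neg-distribˡ-* (+ β) ((+ β) ^ n))

∂-D≗-βG⊛D : ∀ β → ∂ (D β) ≗ ((- + β) · G β) ⊛ D β
∂-D≗-βG⊛D β = begin
    ∂ (D β)
  ≈⟨ ∂-D β ⟩
    (- + β) · E
  ≈⟨ ·-congˡ (- + β) (⊛-identityʳ E) ⟨
    (- + β) · (E ⊛ one)
  ≈⟨ ·-congˡ (- + β) (⊛-congˡ {E} (⊛-inverseˡ D¹ (powS-head {D β} refl 1))) ⟨
    (- + β) · (E ⊛ (invS D¹ ⊛ D¹))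
  ≈⟨ ·-congˡ (- + β) (⊛-congˡ {E} (⊛-congˡ {invS D¹} (⊛-identityʳ (D β)))) ⟩
    (- + β) · (E ⊛ (invS D¹ ⊛ D β))
  ≈⟨ ·-congˡ (- + β) (⊛-assoc E (invS D¹) (D β)) ⟨
    (- + β) · (G β ⊛ D β)
  ≈⟨ ⊛-scaleˡ (- + β) (G β) (D β) ⟨
    ((- + β) · G β) ⊛ D β
  ∎
  where
  open ≗-Reasoning
  E D¹ : EGF
  E = expS (+ β)
  D¹ = powS (D β) 1

∂-invS-powS-D : ∀ β k → ∂ (invS (powS (D β) k)) ≗ (+ (k *ℕ β)) · (G β ⊛ invS (powS (D β) k))
∂-invS-powS-D β k = begin
    ∂ I
  ≈⟨ ∂-invS-powS {D β} {(- + β) · G β} refl (∂-D≗-βG⊛D β) k ⟩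
    (- + k) · (((- + β) · G β) ⊛ I)
  ≈⟨ ·-congˡ (- + k) (⊛-scaleˡ (- + β) (G β) I) ⟩
    (- + k) · ((- + β) · (G β ⊛ I))
  ≈⟨ ·-assoc (- + k) (- + β) (G β ⊛ I) ⟨
    (- + k * - + β) · (G β ⊛ I)
  ≈⟨ (λ n → cong (_* (G β ⊛ I) n) (trans (neg-*-neg (+ k) (+ β)) (sym (ℤ.pos-* k β)))) ⟩
    (+ (k *ℕ β)) · (G β ⊛ I)
  ∎
  where
  open ≗-Reasoning
  I : EGF
  I = invS (powS (D β) k)
  neg-*-neg : ∀ a b → - a * - b ≡ a * b
  neg-*-neg = solve-∀

-- The recurrence holds for all λ', β and γ.
theorem8 : (λ' β γ : ℕ) → (λ' , γ) ≢ (0 , 0) → 1 ≤ β → (n : ℕ) →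
    H (suc n) λ' β γ ≡ + γ * H n λ' β γ + + (λ' *ℕ β) * sumTo n (λ i → + (n C i) * (H i 1 β β * H (n ∸ i) λ' β γ))
theorem8 λ' β γ _ _ n = begin
    H (suc n) λ' β γ
  ≡⟨ ∂-⊛ E I n ⟩
    (∂ E ⊛ I) n + (E ⊛ ∂ I) n
  ≡⟨ cong₂ _+_ (⊛-scaleˡ (+ γ) E I n) (E⊛∂I n) ⟩
    + γ * H n λ' β γ + + (λ' *ℕ β) * (G β ⊛ (E ⊛ I)) n
  ∎
  where
  open ≡-Reasoning
  E I : EGF
  E = expS (+ γ)
  I = invS (powS (D β) λ')
  E⊛∂I : E ⊛ ∂ I ≗ (+ (λ' *ℕ β)) · (G β ⊛ (E ⊛ I))
  E⊛∂I m = trans (⊛-congˡ {E} (∂-invS-powS-D β λ') m)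
           (trans (⊛-scaleʳ (+ (λ' *ℕ β)) E (G β ⊛ I) m)
                  (cong (+ (λ' *ℕ β) *_) (⊛-leftComm E (G β) I m)))
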